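{- Let $G=U(T_1,T_2,\dots,T_g)$ and $G_1=U(\widetilde{T_1},T_2,\dots,T_g)$ be two unicyclic graphs of order $n$ with girth $g$ (with the same cycle $u_1\cdots u_g$, where $T_1$ and $\widetilde{T_1}$ are both trees containing $u_1$). If $|V(T_1)|=|V(\widetilde{T_1})|=n_1$, $W(T_1)\ge W(\widetilde{T_1})$ and $d_{T_1}(u_1)\ge d_{\widetilde{T_1}}(u_1)$, then $W(G)\ge W(G_1)$, with equality if and only if $W(T_1)=W(\widetilde{T_1})$ and $d_{T_1}(u_1)=d_{\widetilde{T_1}}(u_1)$.
   Context: All graphs are finite, simple, undirected and connected. $d_H(u,v)$ is the distance in $H$; $d_H(v)=\sum_{w\in V(H)} d_H(v,w)$; $W(H)=\sum_{\{u,v\}\subseteq V(H)} d_H(u,v)$ is the Wiener index. A unicyclic graph is a connected graph with exactly one cycle, its girth the cycle length. If $C_g=u_1\cdots u_g$ is the cycle of $G$, $G-E(C_g)$ consists of trees $T_1,\dots,T_g$ with $u_i\in V(T_i)$ and we write $G=U(T_1,\dots,T_g)$; conversely $U(T_1,\dots,T_g)$ denotes the graph obtained from the cycle by attaching the tree $T_i$ at $u_i$ (identifying $u_i$ with the root of $T_i$). -}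

module Defs where

open import Data.Nat using (ℕ; zero; suc; _<_; _≡ᵇ_; _<ᵇ_)
open import Data.Bool using (Bool; _∧_; _∨_; if_then_else_)
open import Data.List using (List; []; _∷_; map; _++_; length; upTo; concatMap)
open import Data.Nat.ListAction using (sum)
open import Data.Bool.ListAction using (any)
open import Data.Product using (_×_; _,_; uncurry)
open import Data.Fin using (Fin; toℕ)
open import Data.Vec using (Vec; lookup; allFin; toList)

-- A finite simple graph given by a duplicate-free list of its vertices
-- and a (symmetric, irreflexive) Boolean adjacency relation.
record Graph : Set₁ where
  field
    V     : Set
    verts : List V
    eqV   : V → V → Bool
    adj   : V → V → Bool

module _ (G : Graph) where
  open Graph G

  reach : ℕ → V → V → Bool
  reach zero    u v = eqV u v
  reach (suc k) u v = reach k u v ∨ any (λ w → reach k u w ∧ adj w v) verts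

  distSearch : ℕ → ℕ → V → V → ℕ
  distSearch k zero    u v = k
  distSearch k (suc f) u v = if reach k u v then k else distSearch (suc k) f u v

  -- graph distance d_G(u,v) (for connected G, shortest walks have length < |V|)
  dist : V → V → ℕ
  dist u v = distSearch 0 (length verts) u v

  -- d_G(v) = Σ_w d_G(v,w)
  transmission : V → ℕ
  transmission v = sum (map (dist v) verts)

  pairs : List V → List (V × V)
  pairs []       = []
  pairs (x ∷ xs) = map (x ,_) xs ++ pairs xs

  wiener : ℕ
  wiener = sum (map (uncurry dist) (pairs verts))

-- A rooted tree with vertices 0,…,m (so suc m vertices), root 0,
-- every vertex i > 0 having a parent  parent i < i.
-- (Every finite rooted tree is isomorphic to one of this form.)
record RootedTree : Set where
  field
    m      : ℕ
    parent : ℕ → ℕ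
    parent< : ∀ i → 0 < i → i < suc m → parent i < i

size : RootedTree → ℕ
size T = suc (RootedTree.m T)

treeAdj : RootedTree → ℕ → ℕ → Bool
treeAdj T a b = ((0 <ᵇ a) ∧ (RootedTree.parent T a ≡ᵇ b))
              ∨ ((0 <ᵇ b) ∧ (RootedTree.parent T b ≡ᵇ a))

treeGraph : RootedTree → Graph
treeGraph T = record
  { V = ℕ ; verts = upTo (size T) ; eqV = _≡ᵇ_ ; adj = treeAdj T }

cycAdj : (g : ℕ) → Fin g → Fin g → Bool
cycAdj g i j =
     (suc (toℕ i) ≡ᵇ toℕ j) ∨ (suc (toℕ j) ≡ᵇ toℕ i)
  ∨ ((toℕ i ≡ᵇ 0) ∧ (suc (toℕ j) ≡ᵇ g))
  ∨ ((toℕ j ≡ᵇ 0) ∧ (suc (toℕ i) ≡ᵇ g))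

-- U(T_1,…,T_g): the cycle C_g with tree T_i attached (by its root) at u_i.
-- Vertex (i , a) is vertex a of T_i; (i , 0) is the cycle vertex u_i.
U : ∀ {g} → Vec RootedTree g → Graph
U {g} Ts = record
  { V = Fin g × ℕ
  ; verts = concatMap (λ i → map (i ,_) (upTo (size (lookup Ts i)))) (toList (allFin g))
  ; eqV = λ { (i , a) (j , b) → (toℕ i ≡ᵇ toℕ j) ∧ (a ≡ᵇ b) }
  ; adj = λ { (i , a) (j , b) →
        ((toℕ i ≡ᵇ toℕ j) ∧ treeAdj (lookup Ts i) a b)
      ∨ ((a ≡ᵇ 0) ∧ (b ≡ᵇ 0) ∧ cycAdj g i j) }
  }

-- The cycle vertex u₁ is a cut vertex separating T₁ from the set O of the other n − n₁ vertices,
-- and distances between vertices of T₁ are the same in G as in T₁. Splitting W(G) over pairs inside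
-- T₁, pairs across u₁ and pairs inside O therefore gives
--   W(G) = W(T₁) + (n − n₁) d_{T₁}(u₁) + n₁ Σ_{y ∈ O} d_G(u₁, y) + Σ_{{x,y} ⊆ O} d_G(x, y),
-- and the last two terms depend on T₁ only through n₁, because contracting T₁ onto u₁ changes no
-- distance within O ∪ {u₁}. As n − n₁ > 0, W(G) is strictly increasing in W(T₁) and in d_{T₁}(u₁).
module Submission where

open import Defs
open import Data.Bool.Base using (true; false; T; _∧_)
open import Data.Bool.Properties using (T-∧; T-∨; T?; ∨-comm)
open import Data.Empty using (⊥-elim)
open import Data.Fin.Base using (Fin; zero; suc; toℕ; inject₁)
open import Data.Fin.Properties using (toℕ-injective; toℕ-inject₁)
open import Data.List.Base using (List; []; _∷_; map; _++_; length; upTo; concat; concatMap)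
open import Data.List.Membership.Propositional using (_∈_; find; lose)
open import Data.List.Membership.Propositional.Properties
  using (∈-upTo⁺; ∈-upTo⁻; ∈-map⁺; ∈-map⁻; ∈-concat⁺′; ∈-concat⁻′; ∈-++⁺ʳ; ∈-length)
import Data.List.Membership.DecPropositional as DecMembership
open import Data.List.Properties using (map-++; map-∘; map-cong-local; length-++; length-map; length-upTo)
open import Data.List.Relation.Unary.All as All using (All; []; _∷_)
open import Data.List.Relation.Unary.All.Properties.Core using (¬Any⇒All¬)
open import Data.List.Relation.Unary.AllPairs using ([]; _∷_)
open import Data.List.Relation.Unary.Any using (here; there)
open import Data.List.Relation.Unary.Any.Properties using (any⁺; any⁻)
open import Data.List.Relation.Unary.Unique.Propositional using (Unique)
open import Data.Nat using (ℕ; zero; suc; _+_; _*_; _≤_; _<_; z≤n; s≤s; _≡ᵇ_; _<ᵇ_)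
open import Data.Nat.Induction using (<-wellFounded)
open import Data.Nat.ListAction using (sum)
open import Data.Nat.ListAction.Properties using (sum-++)
open import Data.Nat.Properties
open import Algebra.Properties.CommutativeSemigroup +-commutativeSemigroup using (interchange)
open import Data.Nat.Tactic.RingSolver using (solve-∀)
open import Data.Product using (Σ; ∃; ∃₂; _×_; _,_; proj₁; proj₂; uncurry)
open import Data.Sum using (_⊎_; inj₁; inj₂)
open import Data.Vec as Vec using (Vec; _∷_; lookup; toList; allFin; tabulate)
open import Data.Vec.Membership.Propositional.Properties using (∈-allFin⁺; ∈-toList⁺)
open import Data.Vec.Properties using (tabulate-∘; toList-map)
open import Function.Base using (id; const; _∘_)
open import Function.Bundles using (_⇔_; mk⇔; Equivalence)
open import Induction.WellFounded using (Acc; acc)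
open import Relation.Binary.Definitions using (DecidableEquality)
open import Relation.Binary.PropositionalEquality
open import Relation.Nullary.Decidable using (map′; yes; no)

open Equivalence using (to; from)
open ≡-Reasoning

-- Walks and distances

record WellFormed (G : Graph) : Set where
  open Graph G
  field
    eqV⇔≡ : ∀ u v → T (eqV u v) ⇔ u ≡ v

  _≟V_ : DecidableEquality V
  u ≟V v = map′ (to (eqV⇔≡ u v)) (from (eqV⇔≡ u v)) (T? (eqV u v))

-- Wrapping T (reach G k u v) in a record lets Agda infer G, k, u and v.
record Reach (G : Graph) (k : ℕ) (u v : Graph.V G) : Set where
  constructor mkReach
  field reached : T (reach G k u v)

Connected : Graph → Set
Connected G = ∀ {u v} → u ∈ verts → v ∈ verts → ∃ λ k → Reach G k u v
  where open Graph G

module _ {G : Graph} where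
  open Graph G

  distSearch-≤ : ∀ f k₀ {k u v} → k₀ ≤ k → Reach G k u v → distSearch G k₀ f u v ≤ k
  distSearch-≤ zero    k₀ k₀≤k r = k₀≤k
  distSearch-≤ (suc f) k₀ {k} {u} {v} k₀≤k (mkReach r) with reach G k₀ u v in eq
  ... | true  = k₀≤k
  ... | false with m≤n⇒m<n∨m≡n k₀≤k
  ...   | inj₁ k₀<k = distSearch-≤ f (suc k₀) k₀<k (mkReach r)
  ...   | inj₂ refl = ⊥-elim (subst T eq r)

  distSearch-reach : ∀ f k₀ {k u v} → k₀ ≤ k → k < k₀ + f → Reach G k u v →
                     Reach G (distSearch G k₀ f u v) u v
  distSearch-reach zero    k₀ k₀≤k k<k₀ _ = ⊥-elim (<⇒≱ k<k₀ (subst (_≤ _) (sym (+-identityʳ k₀)) k₀≤k))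
  distSearch-reach (suc f) k₀ {k} {u} {v} k₀≤k k<k₀+f (mkReach r) with reach G k₀ u v in eq
  ... | true  = mkReach (subst T (sym eq) _)
  ... | false with m≤n⇒m<n∨m≡n k₀≤k
  ...   | inj₁ k₀<k = distSearch-reach f (suc k₀) k₀<k (subst (k <_) (+-suc k₀ f) k<k₀+f) (mkReach r)
  ...   | inj₂ refl = ⊥-elim (subst T eq r)

  dist-≤ : ∀ {k u v} → Reach G k u v → dist G u v ≤ k
  dist-≤ = distSearch-≤ (length verts) 0 z≤n

  dist-reach : ∀ {k u v} → Reach G k u v → k < length verts → Reach G (dist G u v) u v
  dist-reach r k<n = distSearch-reach (length verts) 0 z≤n k<n r

module _ {X : Set} where
  remove : ∀ {x : X} {ys} → x ∈ ys → List X
  remove {ys = _ ∷ ys} (here _)  = ys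
  remove {ys = y ∷ _}  (there p) = y ∷ remove p

  length-remove : ∀ {x : X} {ys} (p : x ∈ ys) → length ys ≡ suc (length (remove p))
  length-remove (here _)  = refl
  length-remove (there p) = cong suc (length-remove p)

  ∈-remove : ∀ {x z : X} {ys} (p : x ∈ ys) → z ∈ ys → x ≢ z → z ∈ remove p
  ∈-remove (here refl) (here refl) x≢z = ⊥-elim (x≢z refl)
  ∈-remove (here refl) (there z∈)  _   = z∈
  ∈-remove (there p)   (here z≡y)  _   = here z≡y
  ∈-remove (there p)   (there z∈)  x≢z = there (∈-remove p z∈ x≢z)

  Unique⊆⇒length≤ : ∀ {xs ys : List X} → Unique xs → All (_∈ ys) xs → length xs ≤ length ys
  Unique⊆⇒length≤ [] [] = z≤n
  Unique⊆⇒length≤ (x∉xs ∷ uq) (x∈ys ∷ xs⊆ys) rewrite length-remove x∈ys =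
    s≤s (Unique⊆⇒length≤ uq (All.zipWith (λ (z∈ , x≢z) → ∈-remove x∈ys z∈ x≢z) (xs⊆ys , x∉xs)))

module Reachability {G : Graph} (wf : WellFormed G) where
  open Graph G
  open WellFormed wf
  open DecMembership _≟V_ using (_∈?_)

  reach-refl : ∀ {u} → Reach G 0 u u
  reach-refl {u} = mkReach (from (eqV⇔≡ u u) refl)

  reach-refl⁻ : ∀ {u v} → Reach G 0 u v → u ≡ v
  reach-refl⁻ {u} {v} (mkReach r) = to (eqV⇔≡ u v) r

  reach-suc : ∀ {k u v} → Reach G k u v → Reach G (suc k) u v
  reach-suc (mkReach r) = mkReach (from T-∨ (inj₁ r))

  reach-step : ∀ {k u w v} → Reach G k u w → w ∈ verts → T (adj w v) → Reach G (suc k) u v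
  reach-step (mkReach r) w∈ e = mkReach (from T-∨ (inj₂ (any⁺ _ (lose w∈ (from T-∧ (r , e))))))

  reach-step⁻ : ∀ {k u v} → Reach G (suc k) u v →
                Reach G k u v ⊎ ∃ λ w → w ∈ verts × Reach G k u w × T (adj w v)
  reach-step⁻ {k} {u} {v} (mkReach r) with to T-∨ r
  ... | inj₁ r′ = inj₁ (mkReach r′)
  ... | inj₂ r′ with find (any⁻ _ verts r′)
  ...   | w , w∈ , rw = let r″ , e = to T-∧ rw in inj₂ (w , w∈ , mkReach r″ , e)

  reach-edge : ∀ {u v} → u ∈ verts → T (adj u v) → Reach G 1 u v
  reach-edge u∈ = reach-step reach-refl u∈

  reach-trans : ∀ {j k u w v} → Reach G j u w → Reach G k w v → Reach G (j + k) u v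
  reach-trans {j} {zero} r r′ rewrite reach-refl⁻ r′ | +-identityʳ j = r
  reach-trans {j} {suc k} r r′ rewrite +-suc j k with reach-step⁻ r′
  ... | inj₁ r″ = reach-suc (reach-trans r r″)
  ... | inj₂ (x , x∈ , r″ , e) = reach-step (reach-trans r r″) x∈ e

  reach-sym : (∀ x y → adj x y ≡ adj y x) → ∀ {k u v} → v ∈ verts → Reach G k u v → Reach G k v u
  reach-sym adj-sym {zero} v∈ r rewrite reach-refl⁻ r = reach-refl
  reach-sym adj-sym {suc k} v∈ r with reach-step⁻ r
  ... | inj₁ r′ = reach-suc (reach-sym adj-sym v∈ r′)
  ... | inj₂ (w , w∈ , r′ , e) =
    reach-trans (reach-edge v∈ (subst T (adj-sym w _) e)) (reach-sym adj-sym w∈ r′)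

  data Walk : V → V → ℕ → Set where
    [_]  : ∀ {v} → v ∈ verts → Walk v v 0
    _∷⟨_⟩_ : ∀ {u w v k} → u ∈ verts → T (adj u w) → Walk w v k → Walk u v (suc k)

  walkVertices : ∀ {u v k} → Walk u v k → List V
  walkVertices ([_] {v} _)       = v ∷ []
  walkVertices (_∷⟨_⟩_ {u} _ _ p) = u ∷ walkVertices p

  length-walkVertices : ∀ {u v k} (p : Walk u v k) → length (walkVertices p) ≡ suc k
  length-walkVertices [ _ ]       = refl
  length-walkVertices (_ ∷⟨ _ ⟩ p) = cong suc (length-walkVertices p)

  walkVertices⊆verts : ∀ {u v k} (p : Walk u v k) → All (_∈ verts) (walkVertices p)
  walkVertices⊆verts [ v∈ ]        = v∈ ∷ []
  walkVertices⊆verts (u∈ ∷⟨ _ ⟩ p) = u∈ ∷ walkVertices⊆verts p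

  walk-snoc : ∀ {u w v k} → Walk u w k → T (adj w v) → v ∈ verts → Walk u v (suc k)
  walk-snoc [ w∈ ]         e v∈ = w∈ ∷⟨ e ⟩ [ v∈ ]
  walk-snoc (u∈ ∷⟨ e′ ⟩ p) e v∈ = u∈ ∷⟨ e′ ⟩ walk-snoc p e v∈

  walk⇒reach : ∀ {u v k} → Walk u v k → Reach G k u v
  walk⇒reach [ _ ]          = reach-refl
  walk⇒reach (u∈ ∷⟨ e ⟩ p) = reach-trans (reach-edge u∈ e) (walk⇒reach p)

  reach⇒walk : ∀ {k u v} → u ∈ verts → v ∈ verts → Reach G k u v → ∃ λ j → Walk u v j
  reach⇒walk {zero} u∈ v∈ r rewrite reach-refl⁻ r = 0 , [ v∈ ]
  reach⇒walk {suc k} u∈ v∈ r with reach-step⁻ r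
  ... | inj₁ r′ = reach⇒walk u∈ v∈ r′
  ... | inj₂ (w , w∈ , r′ , e) with reach⇒walk u∈ w∈ r′
  ...   | j , p = suc j , walk-snoc p e v∈

  Path : V → V → ℕ → Set
  Path u v k = Σ (Walk u v k) (Unique ∘ walkVertices)

  path-suffix : ∀ {u v k x} (p : Path u v k) → x ∈ walkVertices (proj₁ p) → ∃ λ j → Path x v j
  path-suffix ([ v∈ ] , u)           (here refl) = 0 , [ v∈ ] , u
  path-suffix (u∈ ∷⟨ e ⟩ p , u)      (here refl) = _ , u∈ ∷⟨ e ⟩ p , u
  path-suffix (_ ∷⟨ _ ⟩ p , _ ∷ u) (there x∈) = path-suffix (p , u) x∈

  walk⇒path : ∀ {u v k} → Walk u v k → ∃ λ j → Path u v j
  walk⇒path [ v∈ ] = 0 , [ v∈ ] , [] ∷ []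
  walk⇒path (_∷⟨_⟩_ {u} u∈ e p) with walk⇒path p
  ... | j , q , uq with u ∈? walkVertices q
  ...   | yes u∈q = path-suffix (q , uq) u∈q
  ...   | no  u∉q = suc j , u∈ ∷⟨ e ⟩ q , ¬Any⇒All¬ _ u∉q ∷ uq

  -- Defs.dist only searches walks of length < |V|, so it is the distance once such a walk is known.
  reach-short : ∀ {k u v} → u ∈ verts → v ∈ verts → Reach G k u v →
                ∃ λ j → j < length verts × Reach G j u v
  reach-short u∈ v∈ r with reach⇒walk u∈ v∈ r
  ... | _ , p with walk⇒path p
  ...   | j , q , uq = j , bound , walk⇒reach q
    where
      bound : j < length verts
      bound = subst (_≤ length verts) (length-walkVertices q)
                    (Unique⊆⇒length≤ uq (walkVertices⊆verts q))

  dist-realised : Connected G → ∀ {u v} → u ∈ verts → v ∈ verts → Reach G (dist G u v) u v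
  dist-realised connected u∈ v∈ with reach-short u∈ v∈ (proj₂ (connected u∈ v∈))
  ... | _ , k<n , r = dist-reach r k<n

  dist-triangle : Connected G → ∀ {u w v} → u ∈ verts → w ∈ verts → v ∈ verts →
                  dist G u v ≤ dist G u w + dist G w v
  dist-triangle connected u∈ w∈ v∈ =
    dist-≤ (reach-trans (dist-realised connected u∈ w∈) (dist-realised connected w∈ v∈))

dist-cong : ∀ {A B : Graph} → WellFormed A → Connected A →
            ∀ {u v u′ v′} → u ∈ Graph.verts A → v ∈ Graph.verts A →
            length (Graph.verts A) ≤ length (Graph.verts B) →
            (∀ {k} → Reach A k u v → Reach B k u′ v′) → (∀ {k} → Reach B k u′ v′ → Reach A k u v) →
            dist A u v ≡ dist B u′ v′
dist-cong {A} {B} wfA connectedA {u} {v} {u′} {v′} u∈ v∈ |A|≤|B| A⇒B B⇒A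
  with Reachability.reach-short wfA u∈ v∈ (proj₂ (connectedA u∈ v∈))
... | k , k<|A| , r = ≤-antisym (dist-≤ (B⇒A realisedB)) (dist-≤ (A⇒B realisedA))
  where
    realisedA : Reach A (dist A u v) u v
    realisedA = dist-reach r k<|A|
    realisedB : Reach B (dist B u′ v′) u′ v′
    realisedB = dist-reach (A⇒B realisedA) (<-≤-trans (≤-<-trans (dist-≤ r) k<|A|) |A|≤|B|)

record WeakHom (A B : Graph) : Set where
  field
    ⟦_⟧    : Graph.V A → Graph.V B
    ⟦⟧-∈   : ∀ {u} → u ∈ Graph.verts A → ⟦ u ⟧ ∈ Graph.verts B
    ⟦⟧-adj : ∀ {u v} → T (Graph.adj A u v) → ⟦ u ⟧ ≡ ⟦ v ⟧ ⊎ T (Graph.adj B ⟦ u ⟧ ⟦ v ⟧)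

module _ {A B : Graph} (wfA : WellFormed A) (wfB : WellFormed B) (h : WeakHom A B) where
  open WeakHom h
  private
    module RA = Reachability wfA
    module RB = Reachability wfB

  reach-map : ∀ {k u v} → Reach A k u v → Reach B k ⟦ u ⟧ ⟦ v ⟧
  reach-map {zero} r rewrite RA.reach-refl⁻ r = RB.reach-refl
  reach-map {suc k} r with RA.reach-step⁻ r
  ... | inj₁ r′ = RB.reach-suc (reach-map r′)
  ... | inj₂ (w , w∈ , r′ , e) with ⟦⟧-adj e
  ...   | inj₁ ⟦w⟧≡⟦v⟧ = RB.reach-suc (subst (Reach B k _) ⟦w⟧≡⟦v⟧ (reach-map r′))
  ...   | inj₂ e′      = RB.reach-step (reach-map r′) (⟦⟧-∈ w∈) e′

-- Sums over lists and over unordered pairs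

private variable
  X Y : Set

sum-map-++ : ∀ (f : X → ℕ) xs ys → sum (map f (xs ++ ys)) ≡ sum (map f xs) + sum (map f ys)
sum-map-++ f xs ys = trans (cong sum (map-++ f xs ys)) (sum-++ (map f xs) (map f ys))

sum-map-cong : ∀ {f g : X → ℕ} xs → (∀ {x} → x ∈ xs → f x ≡ g x) → sum (map f xs) ≡ sum (map g xs)
sum-map-cong xs f≗g = cong sum (map-cong-local (All.tabulate f≗g))

sum-map-+ : ∀ (f g : X → ℕ) xs → sum (map (λ x → f x + g x) xs) ≡ sum (map f xs) + sum (map g xs)
sum-map-+ f g []       = refl
sum-map-+ f g (x ∷ xs) = trans (cong (f x + g x +_) (sum-map-+ f g xs)) (interchange (f x) (g x) _ _)

sum-map-const : ∀ c (xs : List X) → sum (map (const c) xs) ≡ length xs * c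
sum-map-const c []       = refl
sum-map-const c (_ ∷ xs) = cong (c +_) (sum-map-const c xs)

sum-map-*ˡ : ∀ c (f : X → ℕ) xs → sum (map (λ x → c * f x) xs) ≡ c * sum (map f xs)
sum-map-*ˡ c f []       = sym (*-zeroʳ c)
sum-map-*ˡ c f (x ∷ xs) = trans (cong (c * f x +_) (sum-map-*ˡ c f xs)) (sym (*-distribˡ-+ c (f x) _))

sum-map-sum-+ : ∀ (f : X → ℕ) (g : Y → ℕ) xs ys →
  sum (map (λ x → sum (map (λ y → f x + g y) ys)) xs)
    ≡ length ys * sum (map f xs) + length xs * sum (map g ys)
sum-map-sum-+ f g xs ys = begin
  sum (map (λ x → sum (map (λ y → f x + g y) ys)) xs)
    ≡⟨ sum-map-cong xs (λ {x} _ → trans (sum-map-+ (const (f x)) g ys)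
                                      (cong (_+ sum (map g ys)) (sum-map-const (f x) ys))) ⟩
  sum (map (λ x → length ys * f x + sum (map g ys)) xs)
    ≡⟨ sum-map-+ (λ x → length ys * f x) (const (sum (map g ys))) xs ⟩
  sum (map (λ x → length ys * f x) xs) + sum (map (const (sum (map g ys))) xs)
    ≡⟨ cong₂ _+_ (sum-map-*ˡ (length ys) f xs) (sum-map-const (sum (map g ys)) xs) ⟩
  length ys * sum (map f xs) + length xs * sum (map g ys) ∎

pairSum : (X → X → ℕ) → List X → ℕ
pairSum d []       = 0
pairSum d (x ∷ xs) = sum (map (d x) xs) + pairSum d xs

pairSum-++ : ∀ (d : X → X → ℕ) xs ys → pairSum d (xs ++ ys)
  ≡ pairSum d xs + sum (map (λ x → sum (map (d x) ys)) xs) + pairSum d ys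
pairSum-++ d []       ys = refl
pairSum-++ d (x ∷ xs) ys = begin
  sum (map (d x) (xs ++ ys)) + pairSum d (xs ++ ys)
    ≡⟨ cong₂ _+_ (sum-map-++ (d x) xs ys) (pairSum-++ d xs ys) ⟩
  (sum (map (d x) xs) + sum (map (d x) ys)) + (pairSum d xs + cross + pairSum d ys)
    ≡⟨ rearrange (sum (map (d x) xs)) (sum (map (d x) ys)) (pairSum d xs) cross (pairSum d ys) ⟩
  pairSum d (x ∷ xs) + sum (map (λ x → sum (map (d x) ys)) (x ∷ xs)) + pairSum d ys ∎
  where
    cross : ℕ
    cross = sum (map (λ x → sum (map (d x) ys)) xs)
    rearrange : ∀ a b p c q → (a + b) + (p + c + q) ≡ (a + p) + (b + c) + q
    rearrange = solve-∀

pairSum-cong : ∀ {d d′ : X → X → ℕ} {xs} → (∀ {a b} → a ∈ xs → b ∈ xs → d a b ≡ d′ a b) →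
               pairSum d xs ≡ pairSum d′ xs
pairSum-cong {xs = []}     d≗d′ = refl
pairSum-cong {xs = x ∷ xs} d≗d′ =
  cong₂ _+_ (sum-map-cong xs (λ y∈ → d≗d′ (here refl) (there y∈)))
            (pairSum-cong (λ a∈ b∈ → d≗d′ (there a∈) (there b∈)))

pairSum-map : ∀ (d : Y → Y → ℕ) (f : X → Y) xs →
              pairSum d (map f xs) ≡ pairSum (λ a b → d (f a) (f b)) xs
pairSum-map d f []       = refl
pairSum-map d f (x ∷ xs) = cong₂ _+_ (cong sum (sym (map-∘ xs))) (pairSum-map d f xs)

wiener≡pairSum : ∀ G → wiener G ≡ pairSum (dist G) (Graph.verts G)
wiener≡pairSum G = go (Graph.verts G)
  where
    go : ∀ xs → sum (map (uncurry (dist G)) (pairs G xs)) ≡ pairSum (dist G) xs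
    go []       = refl
    go (x ∷ xs) = trans (sum-map-++ (uncurry (dist G)) (map (x ,_) xs) (pairs G xs))
                        (cong₂ _+_ (cong sum (sym (map-∘ xs))) (go xs))

-- Rooted trees

treeGraph-wf : ∀ τ → WellFormed (treeGraph τ)
treeGraph-wf τ = record { eqV⇔≡ = λ a b → mk⇔ (≡ᵇ⇒≡ a b) (≡⇒≡ᵇ a b) }

module _ (τ : RootedTree) where
  open RootedTree τ
  open Reachability (treeGraph-wf τ)

  treeAdj-sym : ∀ a b → treeAdj τ a b ≡ treeAdj τ b a
  treeAdj-sym a b = ∨-comm ((0 <ᵇ a) ∧ (parent a ≡ᵇ b)) ((0 <ᵇ b) ∧ (parent b ≡ᵇ a))

  reach-root : ∀ {a} → Acc _<_ a → a < size τ → ∃ λ k → Reach (treeGraph τ) k a 0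
  reach-root {zero}  _        _   = 0 , reach-refl
  reach-root {suc a} (acc rs) a<n with reach-root (rs p<a) (<-trans p<a a<n)
    where
      p<a : parent (suc a) < suc a
      p<a = parent< (suc a) (s≤s z≤n) a<n
  ... | k , r = suc k , reach-trans (reach-edge (∈-upTo⁺ a<n) to-parent) r
    where
      to-parent : T (treeAdj τ (suc a) (parent (suc a)))
      to-parent = from (T-∨ {parent (suc a) ≡ᵇ parent (suc a)}) (inj₁ (≡⇒≡ᵇ (parent (suc a)) _ refl))

  root∈ : 0 ∈ Graph.verts (treeGraph τ)
  root∈ = ∈-upTo⁺ (s≤s z≤n)

  treeGraph-connected : Connected (treeGraph τ)
  treeGraph-connected {a} {b} a∈ b∈ with reach-root (<-wellFounded a) (∈-upTo⁻ a∈)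
                                       | reach-root (<-wellFounded b) (∈-upTo⁻ b∈)
  ... | k , a⇝root | l , b⇝root =
    k + l , reach-trans a⇝root (reach-sym treeAdj-sym root∈ b⇝root)

  treeDist-sym : ∀ {a b} → a < size τ → b < size τ → dist (treeGraph τ) a b ≡ dist (treeGraph τ) b a
  treeDist-sym a<n b<n = dist-cong (treeGraph-wf τ) treeGraph-connected (∈-upTo⁺ a<n) (∈-upTo⁺ b<n) ≤-refl
    (reach-sym treeAdj-sym (∈-upTo⁺ b<n)) (reach-sym treeAdj-sym (∈-upTo⁺ a<n))

-- The unicyclic graph U(T₁, …, T_g)

module _ {g : ℕ} (τs : Vec RootedTree g) where
  private
    branch : Fin g → List (Fin g × ℕ)
    branch i = map (i ,_) (upTo (size (lookup τs i)))

  U-vertex⁺ : ∀ i {a} → a < size (lookup τs i) → (i , a) ∈ Graph.verts (U τs)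
  U-vertex⁺ i a<n = ∈-concat⁺′ (∈-map⁺ (i ,_) (∈-upTo⁺ a<n)) (∈-map⁺ branch (∈-toList⁺ (∈-allFin⁺ i)))

  U-vertex⁻ : ∀ {i a} → (i , a) ∈ Graph.verts (U τs) → a < size (lookup τs i)
  U-vertex⁻ ia∈ with ∈-concat⁻′ (map branch (toList (allFin g))) ia∈
  ... | _ , ia∈branch , branch∈ with ∈-map⁻ branch branch∈
  ...   | j , _ , refl with ∈-map⁻ (j ,_) ia∈branch
  ...     | _ , a∈ , refl = ∈-upTo⁻ a∈

  U-wf : WellFormed (U τs)
  U-wf = record { eqV⇔≡ = λ u v → mk⇔ (sound u v) (complete u v) }
    where
      sound : ∀ u v → T (Graph.eqV (U τs) u v) → u ≡ v
      sound (i , a) (j , b) e with to T-∧ e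
      ... | i≡j , a≡b = cong₂ _,_ (toℕ-injective (≡ᵇ⇒≡ (toℕ i) (toℕ j) i≡j)) (≡ᵇ⇒≡ a b a≡b)
      complete : ∀ u v → u ≡ v → T (Graph.eqV (U τs) u v)
      complete (i , a) _ refl = from T-∧ (≡⇒≡ᵇ (toℕ i) _ refl , ≡⇒≡ᵇ a _ refl)

  treeInU : ∀ i → WeakHom (treeGraph (lookup τs i)) (U τs)
  treeInU i = record
    { ⟦_⟧    = i ,_
    ; ⟦⟧-∈   = λ a∈ → U-vertex⁺ i (∈-upTo⁻ a∈)
    ; ⟦⟧-adj = λ e → inj₂ (from (T-∨ {(toℕ i ≡ᵇ toℕ i) ∧ _}) (inj₁ (from T-∧ (≡⇒≡ᵇ (toℕ i) _ refl , e))))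
    }

  U-adj⁻ : ∀ i a j b → T (Graph.adj (U τs) (i , a) (j , b)) →
           (toℕ i ≡ toℕ j × T (treeAdj (lookup τs i) a b)) ⊎ (a ≡ 0 × b ≡ 0 × T (cycAdj g i j))
  U-adj⁻ i a j b e with to (T-∨ {(toℕ i ≡ᵇ toℕ j) ∧ treeAdj (lookup τs i) a b}) e
  ... | inj₁ in-tree with to (T-∧ {toℕ i ≡ᵇ toℕ j}) in-tree
  ...   | i≡j , e′ = inj₁ (≡ᵇ⇒≡ (toℕ i) (toℕ j) i≡j , e′)
  U-adj⁻ i a j b e | inj₂ on-cycle with to (T-∧ {a ≡ᵇ 0}) on-cycle
  ...   | a≡0 , e′ with to (T-∧ {b ≡ᵇ 0}) e′
  ...     | b≡0 , e″ = inj₂ (≡ᵇ⇒≡ a 0 a≡0 , ≡ᵇ⇒≡ b 0 b≡0 , e″)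

  U-cycle-adj : ∀ i j {a b} → a ≡ 0 → b ≡ 0 → T (cycAdj g i j) → T (Graph.adj (U τs) (i , a) (j , b))
  U-cycle-adj i j refl refl = from (T-∨ {(toℕ i ≡ᵇ toℕ j) ∧ treeAdj (lookup τs i) 0 0}) ∘ inj₂

  cycle-edge : ∀ {i j : Fin g} → suc (toℕ i) ≡ toℕ j →
               T (Graph.adj (U τs) (i , 0) (j , 0)) × T (Graph.adj (U τs) (j , 0) (i , 0))
  cycle-edge {i} {j} e =
      U-cycle-adj i j refl refl (from (T-∨ {suc (toℕ i) ≡ᵇ toℕ j}) (inj₁ i~j))
    , U-cycle-adj j i refl refl
        (from (T-∨ {suc (toℕ j) ≡ᵇ toℕ i}) (inj₂ (from (T-∨ {suc (toℕ i) ≡ᵇ toℕ j}) (inj₁ i~j))))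
    where
      i~j : T (suc (toℕ i) ≡ᵇ toℕ j)
      i~j = ≡⇒≡ᵇ _ _ e

u₁ : ∀ {n} → Fin (suc n) × ℕ
u₁ = zero , 0

module _ {n : ℕ} (τs : Vec RootedTree (suc n)) where
  open Reachability (U-wf τs)

  cycle-reach : ∀ t (i : Fin (suc n)) → toℕ i ≡ t →
                Reach (U τs) t (i , 0) u₁ × Reach (U τs) t u₁ (i , 0)
  cycle-reach zero    zero    _  = reach-refl , reach-refl
  cycle-reach (suc t) (suc i) eq
    with cycle-reach t (inject₁ i) (trans (toℕ-inject₁ i) (suc-injective eq))
  ... | to-u₁ , from-u₁ =
      reach-trans (reach-edge (U-vertex⁺ τs (suc i) (s≤s z≤n)) (proj₂ edge)) to-u₁
    , reach-step from-u₁ (U-vertex⁺ τs (inject₁ i) (s≤s z≤n)) (proj₁ edge)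
    where
      edge : T (Graph.adj (U τs) (inject₁ i , 0) (suc i , 0))
           × T (Graph.adj (U τs) (suc i , 0) (inject₁ i , 0))
      edge = cycle-edge τs (cong suc (toℕ-inject₁ i))

  reach-u₁ : ∀ {u} → u ∈ Graph.verts (U τs) →
                 (∃ λ k → Reach (U τs) k u u₁) × (∃ λ k → Reach (U τs) k u₁ u)
  reach-u₁ {i , a} u∈
    with cycle-reach (toℕ i) i refl
       | treeGraph-connected (lookup τs i) (∈-upTo⁺ (U-vertex⁻ τs u∈)) (root∈ (lookup τs i))
       | treeGraph-connected (lookup τs i) (root∈ (lookup τs i)) (∈-upTo⁺ (U-vertex⁻ τs u∈))
  ... | root⇝u₁ , u₁⇝root | k , a⇝root | l , root⇝a =
      (k + toℕ i , reach-trans (inU a⇝root) root⇝u₁)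
    , (toℕ i + l , reach-trans u₁⇝root (inU root⇝a))
    where
      inU : ∀ {m x y} → Reach (treeGraph (lookup τs i)) m x y → Reach (U τs) m (i , x) (i , y)
      inU = reach-map (treeGraph-wf (lookup τs i)) (U-wf τs) (treeInU τs i)

  U-connected : Connected (U τs)
  U-connected u∈ v∈ with reach-u₁ u∈ | reach-u₁ v∈
  ... | (k , u⇝u₁) , _ | _ , (l , u₁⇝v) = k + l , reach-trans u⇝u₁ u₁⇝v

-- Splitting off T₁

module _ {k : ℕ} (τs : Vec RootedTree k) where
  private
    branch : Fin k → List (Fin (suc k) × ℕ)
    branch j = map (suc j ,_) (upTo (size (lookup τs j)))

  others : List (Fin (suc k) × ℕ)
  others = concatMap branch (toList (allFin k))

  module _ (τ : RootedTree) where
    private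
      G : Graph
      G = U (τ ∷ τs)

    treeVertices : List (Fin (suc k) × ℕ)
    treeVertices = map (zero ,_) (upTo (size τ))

    U-verts : Graph.verts G ≡ treeVertices ++ others
    U-verts = cong (treeVertices ++_) (begin
      concat (map branch′ (toList (tabulate suc)))
        ≡⟨ cong (concat ∘ map branch′ ∘ toList) (tabulate-∘ suc id) ⟩
      concat (map branch′ (toList (Vec.map suc (allFin k))))
        ≡⟨ cong (concat ∘ map branch′) (toList-map suc (allFin k)) ⟩
      concat (map branch′ (map suc (toList (allFin k))))
        ≡⟨ cong concat (map-∘ (toList (allFin k))) ⟨
      others ∎)
      where
        branch′ : Fin (suc k) → List (Fin (suc k) × ℕ)
        branch′ i = map (i ,_) (upTo (size (lookup (τ ∷ τs) i)))

    length-U-verts : length (Graph.verts G) ≡ size τ + length others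
    length-U-verts = begin
      length (Graph.verts G)               ≡⟨ cong length U-verts ⟩
      length (treeVertices ++ others)      ≡⟨ length-++ treeVertices ⟩
      length treeVertices + length others  ≡⟨ cong (_+ length others) length-treeVertices ⟩
      size τ + length others               ∎
      where
        length-treeVertices : length treeVertices ≡ size τ
        length-treeVertices = trans (length-map (zero ,_) (upTo (size τ))) (length-upTo (size τ))

    others⊆U : ∀ {y} → y ∈ others → y ∈ Graph.verts G
    others⊆U {y} y∈ = subst (y ∈_) (sym U-verts) (∈-++⁺ʳ treeVertices y∈)

  others⁻ : ∀ {y} → y ∈ others → ∃₂ λ j b → y ≡ (suc j , b)
  others⁻ y∈ with ∈-concat⁻′ (map branch (toList (allFin k))) y∈
  ... | _ , y∈branch , branch∈ with ∈-map⁻ branch branch∈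
  ...   | j , _ , refl with ∈-map⁻ (suc j ,_) y∈branch
  ...     | b , _ , y≡ = j , b , y≡

  others-nonempty : Fin k → 0 < length others
  others-nonempty j =
    ∈-length (∈-concat⁺′ (∈-map⁺ (suc j ,_) (∈-upTo⁺ (s≤s z≤n)))
                         (∈-map⁺ branch (∈-toList⁺ (∈-allFin⁺ j))))

module _ {k : ℕ} (τs : Vec RootedTree k) where

  projectToTree : ∀ τ → WeakHom (U (τ ∷ τs)) (treeGraph τ)
  projectToTree τ = record { ⟦_⟧ = π ; ⟦⟧-∈ = π-∈ ; ⟦⟧-adj = λ {u} {v} → π-adj u v }
    where
      π : Fin (suc k) × ℕ → ℕ
      π (zero  , a) = a
      π (suc _ , _) = 0

      π-∈ : ∀ {u} → u ∈ Graph.verts (U (τ ∷ τs)) → π u ∈ Graph.verts (treeGraph τ)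
      π-∈ {zero  , _} u∈ = ∈-upTo⁺ (U-vertex⁻ (τ ∷ τs) u∈)
      π-∈ {suc _ , _} _  = root∈ τ

      π-adj : ∀ u v → T (Graph.adj (U (τ ∷ τs)) u v) → π u ≡ π v ⊎ T (treeAdj τ (π u) (π v))
      π-adj (zero , a) (zero , b) e with U-adj⁻ (τ ∷ τs) zero a zero b e
      ... | inj₁ (_ , tree-edge)   = inj₂ tree-edge
      ... | inj₂ (refl , refl , _) = inj₁ refl
      π-adj (zero , a) (suc j , b) e with U-adj⁻ (τ ∷ τs) zero a (suc j) b e
      ... | inj₁ (() , _)
      ... | inj₂ (a≡0 , _)         = inj₁ a≡0
      π-adj (suc i , a) (zero , b) e with U-adj⁻ (τ ∷ τs) (suc i) a zero b e
      ... | inj₁ (() , _)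
      ... | inj₂ (_ , b≡0 , _)     = inj₁ (sym b≡0)
      π-adj (suc _ , _) (suc _ , _) _ = inj₁ refl

  collapseTree : ∀ τ τ′ → WeakHom (U (τ ∷ τs)) (U (τ′ ∷ τs))
  collapseTree τ τ′ =
    record { ⟦_⟧ = collapse ; ⟦⟧-∈ = collapse-∈ ; ⟦⟧-adj = λ {u} {v} → collapse-adj u v }
    where
      collapse : Fin (suc k) × ℕ → Fin (suc k) × ℕ
      collapse (zero  , _) = u₁
      collapse (suc j , b) = suc j , b

      collapse-∈ : ∀ {u} → u ∈ Graph.verts (U (τ ∷ τs)) → collapse u ∈ Graph.verts (U (τ′ ∷ τs))
      collapse-∈ {zero  , _} _  = U-vertex⁺ (τ′ ∷ τs) zero (s≤s z≤n)
      collapse-∈ {suc j , _} u∈ = U-vertex⁺ (τ′ ∷ τs) (suc j) (U-vertex⁻ (τ ∷ τs) u∈)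

      collapse-adj : ∀ u v → T (Graph.adj (U (τ ∷ τs)) u v) →
                     collapse u ≡ collapse v ⊎ T (Graph.adj (U (τ′ ∷ τs)) (collapse u) (collapse v))
      collapse-adj (zero  , _) (zero  , _) _ = inj₁ refl
      collapse-adj (zero  , a) (suc j , b) e with U-adj⁻ (τ ∷ τs) zero a (suc j) b e
      ... | inj₁ (() , _)
      ... | inj₂ (_ , b≡0 , c) = inj₂ (U-cycle-adj (τ′ ∷ τs) zero (suc j) refl b≡0 c)
      collapse-adj (suc i , a) (zero  , b) e with U-adj⁻ (τ ∷ τs) (suc i) a zero b e
      ... | inj₁ (() , _)
      ... | inj₂ (a≡0 , _ , c) = inj₂ (U-cycle-adj (τ′ ∷ τs) (suc i) zero a≡0 refl c)
      collapse-adj (suc _ , _) (suc _ , _) e = inj₂ e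

  collapse-fixes : ∀ {τ τ′ x} → x ∈ u₁ ∷ others τs → WeakHom.⟦ collapseTree τ τ′ ⟧ x ≡ x
  collapse-fixes (here refl) = refl
  collapse-fixes (there y∈) with others⁻ τs y∈
  ... | _ , _ , refl = refl

module _ {k : ℕ} (τs : Vec RootedTree k) (τ : RootedTree) where
  private
    G : Graph
    G = U (τ ∷ τs)
  open Reachability (U-wf (τ ∷ τs))

  u₁∈ : u₁ ∈ Graph.verts G
  u₁∈ = U-vertex⁺ (τ ∷ τs) zero (s≤s z≤n)

  dist-treeVertices : ∀ {a b} → a < size τ → b < size τ →
                      dist G (zero , a) (zero , b) ≡ dist (treeGraph τ) a b
  dist-treeVertices a<n b<n = sym (dist-cong (treeGraph-wf τ) (treeGraph-connected τ)
    (∈-upTo⁺ a<n) (∈-upTo⁺ b<n) |τ|≤|G|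
    (reach-map (treeGraph-wf τ) (U-wf (τ ∷ τs)) (treeInU (τ ∷ τs) zero))
    (reach-map (U-wf (τ ∷ τs)) (treeGraph-wf τ) (projectToTree τs τ)))
    where
      |τ|≤|G| : length (upTo (size τ)) ≤ length (Graph.verts G)
      |τ|≤|G| = subst₂ _≤_ (sym (length-upTo (size τ))) (sym (length-U-verts τs τ)) (m≤m+n (size τ) _)

  reach-through-u₁ : ∀ m {a j b} → Reach G m (zero , a) (suc j , b) →
    ∃₂ λ m₁ m₂ → m₁ + m₂ ≤ m × Reach G m₁ (zero , a) u₁ × Reach G m₂ u₁ (suc j , b)
  reach-through-u₁ zero r with reach-refl⁻ r
  ... | ()
  reach-through-u₁ (suc m) r with reach-step⁻ r
  ... | inj₁ r′ with reach-through-u₁ m r′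
  ...   | m₁ , m₂ , m₁+m₂≤m , r₁ , r₂ = m₁ , m₂ , m≤n⇒m≤1+n m₁+m₂≤m , r₁ , r₂
  reach-through-u₁ (suc m) {j = j} {b} r | inj₂ ((zero , a′) , w∈ , r′ , e)
    with U-adj⁻ (τ ∷ τs) zero a′ (suc j) b e
  ...   | inj₁ (() , _)
  ...   | inj₂ (refl , _) = m , 1 , ≤-reflexive (+-comm m 1) , r′ , reach-edge w∈ e
  reach-through-u₁ (suc m) r | inj₂ ((suc _ , _) , w∈ , r′ , e) with reach-through-u₁ m r′
  ...   | m₁ , m₂ , m₁+m₂≤m , r₁ , r₂ =
    m₁ , suc m₂ , subst (_≤ suc m) (sym (+-suc m₁ m₂)) (s≤s m₁+m₂≤m) , r₁ , reach-step r₂ w∈ e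

  dist-through-u₁ : ∀ {a y} → a < size τ → y ∈ others τs →
                        dist G (zero , a) y ≡ dist (treeGraph τ) 0 a + dist G u₁ y
  dist-through-u₁ {a} a<n y∈ with others⁻ τs y∈
  ... | j , b , refl = begin
    dist G (zero , a) (suc j , b)                   ≡⟨ ≤-antisym triangle (split (reach-through-u₁ _ realised)) ⟩
    dist G (zero , a) u₁ + dist G u₁ (suc j , b)    ≡⟨ cong (_+ dist G u₁ (suc j , b)) a⇝u₁ ⟩
    dist (treeGraph τ) 0 a + dist G u₁ (suc j , b)  ∎
    where
      a∈ : (zero , a) ∈ Graph.verts G
      a∈ = U-vertex⁺ (τ ∷ τs) zero a<n
      a⇝u₁ : dist G (zero , a) u₁ ≡ dist (treeGraph τ) 0 a
      a⇝u₁ = trans (dist-treeVertices a<n (s≤s z≤n)) (treeDist-sym τ a<n (s≤s z≤n))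
      y∈G : (suc j , b) ∈ Graph.verts G
      y∈G = others⊆U τs τ y∈
      triangle : dist G (zero , a) (suc j , b) ≤ dist G (zero , a) u₁ + dist G u₁ (suc j , b)
      triangle = dist-triangle (U-connected (τ ∷ τs)) a∈ u₁∈ y∈G
      realised : Reach G (dist G (zero , a) (suc j , b)) (zero , a) (suc j , b)
      realised = dist-realised (U-connected (τ ∷ τs)) a∈ y∈G
      split : (∃₂ λ m₁ m₂ → m₁ + m₂ ≤ dist G (zero , a) (suc j , b) ×
                 Reach G m₁ (zero , a) u₁ × Reach G m₂ u₁ (suc j , b)) →
              dist G (zero , a) u₁ + dist G u₁ (suc j , b) ≤ dist G (zero , a) (suc j , b)
      split (_ , _ , m₁+m₂≤d , r₁ , r₂) = ≤-trans (+-mono-≤ (dist-≤ r₁) (dist-≤ r₂)) m₁+m₂≤d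

  wienerRemainder : ℕ
  wienerRemainder = size τ * sum (map (dist G u₁) (others τs)) + pairSum (dist G) (others τs)

  wiener-U : wiener G
           ≡ wiener (treeGraph τ) + length (others τs) * transmission (treeGraph τ) 0 + wienerRemainder
  wiener-U = begin
    wiener G                                           ≡⟨ wiener≡pairSum G ⟩
    pairSum (dist G) (Graph.verts G)                   ≡⟨ cong (pairSum (dist G)) (U-verts τs τ) ⟩
    pairSum (dist G) (treeVertices τs τ ++ others τs)
      ≡⟨ pairSum-++ (dist G) (treeVertices τs τ) (others τs) ⟩
    pairSum (dist G) (treeVertices τs τ) + cross + pairSum (dist G) (others τs)
      ≡⟨ cong₂ (λ w x → w + x + pairSum (dist G) (others τs)) inside-tree cross≡ ⟩
    wiener (treeGraph τ) + (r * t + size τ * S) + pairSum (dist G) (others τs)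
      ≡⟨ rearrange (wiener (treeGraph τ)) (r * t) (size τ * S) _ ⟩
    wiener (treeGraph τ) + r * t + wienerRemainder                  ∎
    where
      r t S cross : ℕ
      r = length (others τs)
      t = transmission (treeGraph τ) 0
      S = sum (map (dist G u₁) (others τs))
      cross = sum (map (λ x → sum (map (dist G x) (others τs))) (treeVertices τs τ))
      rearrange : ∀ a b c d → a + (b + c) + d ≡ a + b + (c + d)
      rearrange = solve-∀
      inside-tree : pairSum (dist G) (treeVertices τs τ) ≡ wiener (treeGraph τ)
      inside-tree = begin
        pairSum (dist G) (treeVertices τs τ)
          ≡⟨ pairSum-map (dist G) (zero ,_) (upTo (size τ)) ⟩
        pairSum (λ a b → dist G (zero , a) (zero , b)) (upTo (size τ))
          ≡⟨ pairSum-cong (λ a∈ b∈ → dist-treeVertices (∈-upTo⁻ a∈) (∈-upTo⁻ b∈)) ⟩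
        pairSum (dist (treeGraph τ)) (upTo (size τ))  ≡⟨ wiener≡pairSum (treeGraph τ) ⟨
        wiener (treeGraph τ)                          ∎
      cross≡ : cross ≡ r * t + size τ * S
      cross≡ = begin
        cross
          ≡⟨ cong sum (map-∘ (upTo (size τ))) ⟨
        sum (map (λ a → sum (map (dist G (zero , a)) (others τs))) (upTo (size τ)))
          ≡⟨ sum-map-cong (upTo (size τ)) (λ a∈ → sum-map-cong (others τs) (dist-through-u₁ (∈-upTo⁻ a∈))) ⟩
        sum (map (λ a → sum (map (λ y → dist (treeGraph τ) 0 a + dist G u₁ y) (others τs)))
                 (upTo (size τ)))
          ≡⟨ sum-map-sum-+ (dist (treeGraph τ) 0) (dist G u₁) (upTo (size τ)) (others τs) ⟩
        r * t + length (upTo (size τ)) * S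
          ≡⟨ cong (λ n → r * t + n * S) (length-upTo (size τ)) ⟩
        r * t + size τ * S ∎

module _ {k : ℕ} (τs : Vec RootedTree k) {τ τ′ : RootedTree} (|τ|≡|τ′| : size τ ≡ size τ′) where
  private
    G G′ : Graph
    G  = U (τ ∷ τs)
    G′ = U (τ′ ∷ τs)

  dist-outside-invariant : ∀ {x y} → x ∈ u₁ ∷ others τs → y ∈ u₁ ∷ others τs →
                           dist G x y ≡ dist G′ x y
  dist-outside-invariant x∈ y∈ =
    dist-cong (U-wf (τ ∷ τs)) (U-connected (τ ∷ τs)) (∈G x∈) (∈G y∈) |G|≤|G′|
      (λ {m} r → subst₂ (Reach G′ m) (collapse-fixes τs {τ} {τ′} x∈) (collapse-fixes τs {τ} {τ′} y∈)
                   (reach-map (U-wf (τ ∷ τs)) (U-wf (τ′ ∷ τs)) (collapseTree τs τ τ′) r))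
      (λ {m} r → subst₂ (Reach G m) (collapse-fixes τs {τ′} {τ} x∈) (collapse-fixes τs {τ′} {τ} y∈)
                   (reach-map (U-wf (τ′ ∷ τs)) (U-wf (τ ∷ τs)) (collapseTree τs τ′ τ) r))
    where
      ∈G : ∀ {x} → x ∈ u₁ ∷ others τs → x ∈ Graph.verts G
      ∈G (here refl) = u₁∈ τs τ
      ∈G (there y∈)  = others⊆U τs τ y∈
      |G|≤|G′| : length (Graph.verts G) ≤ length (Graph.verts G′)
      |G|≤|G′| = ≤-reflexive (begin
        length (Graph.verts G)        ≡⟨ length-U-verts τs τ ⟩
        size τ + length (others τs)   ≡⟨ cong (_+ length (others τs)) |τ|≡|τ′| ⟩
        size τ′ + length (others τs)  ≡⟨ length-U-verts τs τ′ ⟨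
        length (Graph.verts G′)       ∎)

  wienerRemainder-invariant : wienerRemainder τs τ ≡ wienerRemainder τs τ′
  wienerRemainder-invariant = cong₂ _+_
    (cong₂ _*_ |τ|≡|τ′| (sum-map-cong (others τs) (dist-outside-invariant (here refl) ∘ there)))
    (pairSum-cong (λ x∈ y∈ → dist-outside-invariant (there x∈) (there y∈)))

dominated-+-*-≡⇒≡ : ∀ {r w w′ t t′} → 0 < r → w′ ≤ w → t′ ≤ t →
                    w + r * t ≡ w′ + r * t′ → w ≡ w′ × t ≡ t′
dominated-+-*-≡⇒≡ {suc r} {w} {w′} {t} {t′} _ w′≤w t′≤t eq = w≡w′ , t≡t′
  where
    w+rt≤w′+rt : w + suc r * t ≤ w′ + suc r * t
    w+rt≤w′+rt = ≤-trans (≤-reflexive eq) (+-monoʳ-≤ w′ (*-monoʳ-≤ (suc r) t′≤t))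
    w≡w′ : w ≡ w′
    w≡w′ = ≤-antisym (+-cancelʳ-≤ (suc r * t) w w′ w+rt≤w′+rt) w′≤w
    t≡t′ : t ≡ t′
    t≡t′ = *-cancelˡ-≡ t t′ (suc r) (+-cancelˡ-≡ w′ _ _ (subst (λ x → x + suc r * t ≡ w′ + suc r * t′) w≡w′ eq))

corollary2p2 : (k : ℕ) → 3 ≤ suc k →
    (T₁ T̃₁ : RootedTree) (Ts : Vec RootedTree k) →
    size T₁ ≡ size T̃₁ →
    wiener (treeGraph T̃₁) ≤ wiener (treeGraph T₁) →
    transmission (treeGraph T̃₁) 0 ≤ transmission (treeGraph T₁) 0 →
    (wiener (U (T̃₁ ∷ Ts)) ≤ wiener (U (T₁ ∷ Ts)))
    × ((wiener (U (T₁ ∷ Ts)) ≡ wiener (U (T̃₁ ∷ Ts)))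
       ⇔ ((wiener (treeGraph T₁) ≡ wiener (treeGraph T̃₁))
          × (transmission (treeGraph T₁) 0 ≡ transmission (treeGraph T̃₁) 0)))
corollary2p2 zero (s≤s ())
corollary2p2 (suc k) _ T₁ T̃₁ Ts |T₁|≡|T̃₁| W̃≤W d̃≤d =
    subst₂ _≤_ (sym G̃-formula) (sym G-formula) (+-monoˡ-≤ R (+-mono-≤ W̃≤W (*-monoʳ-≤ r d̃≤d)))
  , mk⇔ (λ eq → dominated-+-*-≡⇒≡ (others-nonempty Ts zero) W̃≤W d̃≤d
                  (+-cancelʳ-≡ R _ _ (trans (sym G-formula) (trans eq G̃-formula))))
        (λ (W≡W̃ , d≡d̃) →
           trans G-formula (trans (cong₂ (λ w t → w + r * t + R) W≡W̃ d≡d̃) (sym G̃-formula)))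
  where
    r R : ℕ
    r = length (others Ts)
    R = wienerRemainder Ts T₁
    G-formula : wiener (U (T₁ ∷ Ts)) ≡ wiener (treeGraph T₁) + r * transmission (treeGraph T₁) 0 + R
    G-formula = wiener-U Ts T₁
    G̃-formula : wiener (U (T̃₁ ∷ Ts)) ≡ wiener (treeGraph T̃₁) + r * transmission (treeGraph T̃₁) 0 + R
    G̃-formula = trans (wiener-U Ts T̃₁)
      (cong (wiener (treeGraph T̃₁) + r * transmission (treeGraph T̃₁) 0 +_)
            (sym (wienerRemainder-invariant Ts {T₁} {T̃₁} |T₁|≡|T̃₁|)))
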